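{- Let $k\geq 2$ and let $G_k$ and $G_{k+1}$ be the graphs defined below (for $\ell = 1$). Let $\psi$ be the map given by $\psi(0)=0$ and $\psi(m)=m+2^{k-1}$ for nonzero nodes $m$. Then $\psi$ is a color-preserving graph isomorphism from $G_k$ with the node $2^k-1$ (and its incident edges) removed onto $B_2$ of $G_{k+1}$.
   Context: The pruning function $\operatorname{P}_{1}:\mathbb{Z}_{>0}\to\mathbb{Z}_{\geq 0}$: write $m$ in binary, padded on the left with zeros as needed, let $z$ be the position (position $0$ = least significant bit) of the first zero bit counted from the right, let $q = 2^{z}\lfloor m/2^{z}\rfloor$, and set $\operatorname{P}_1(m)=\max(q-1,0)$. For an integer $k\ge 2$, $G_k$ is the directed graph with node set $\{0\}\cup\{2^{k-1}-1,\ldots,2^k-1\}$ and edges: for each $m$ with $2^{k-1}-1\le m<2^k-1$, a "blue" edge from $m$ to $m+1$ and a "red" edge from $\operatorname{P}_1(m)$ to $m$ (blue edges carry a fixed weight $-n$, red edges weight $+1$). For $k\ge 3$ set $I_t^k = 2^k-1$, $I_b^k=2^k-2^{k-2}-1$, $II_t^k=2^k-2^{k-2}-2$, $II_b^k=2^{k-1}-1$. $B_1$ of $G_k$ is the induced subgraph of $G_k$ on $\{0\}\cup\{I_b^k,\ldots,I_t^k\}$, and $B_2$ of $G_k$ is the induced subgraph on $\{0\}\cup\{II_b^k,\ldots,II_t^k\}$. -}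

module Defs where

open import Data.Nat using (ℕ; zero; suc; _+_; _*_; _∸_; _^_; _≤_; _<_; _≡ᵇ_)
open import Data.Nat.DivMod using (_/_; _%_)
open import Data.Bool using (if_then_else_)
open import Data.Product using (_×_; ∃)
open import Data.Sum using (_⊎_)
open import Relation.Binary.PropositionalEquality using (_≡_; _≢_)
open import Function.Bundles using (_⇔_)

-- number of trailing one bits of m = position z of the first zero bit from
-- the right (position 0 = least significant).  'fuel' bounds the recursion;
-- fuel = m suffices since the number of trailing ones of m is ≤ m.
trailingOnesF : ℕ → ℕ → ℕ
trailingOnesF zero    m = zero
trailingOnesF (suc f) m = if (m % 2 ≡ᵇ 1) then suc (trailingOnesF f (m / 2)) else zero

trailingOnes : ℕ → ℕ
trailingOnes m = trailingOnesF m m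

-- pruning function P₁(m) = max(2^z ⌊m/2^z⌋ - 1, 0)  (truncated subtraction)
P₁ : ℕ → ℕ
P₁ m = let z = trailingOnes m in
       let instance _ = Data.Nat.>-nonZero (Data.Nat.Properties.m^n>0 2 z) in
       (2 ^ z * (m / 2 ^ z)) ∸ 1
  where import Data.Nat
        import Data.Nat.Properties

data Color : Set where
  blue red : Color

record Graph : Set₁ where
  field
    Node : ℕ → Set
    Edge : Color → ℕ → ℕ → Set
open Graph public

G : ℕ → Graph
Node (G k) m = m ≡ 0 ⊎ ((2 ^ (k ∸ 1) ∸ 1 ≤ m) × (m ≤ 2 ^ k ∸ 1))
Edge (G k) blue u v = ((2 ^ (k ∸ 1) ∸ 1 ≤ u) × (u < 2 ^ k ∸ 1)) × v ≡ suc u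
Edge (G k) red  u v = ((2 ^ (k ∸ 1) ∸ 1 ≤ v) × (v < 2 ^ k ∸ 1)) × u ≡ P₁ v

induced : Graph → (ℕ → Set) → Graph
Node (induced Γ S) m = Node Γ m × S m
Edge (induced Γ S) c u v = Edge Γ c u v × (Node Γ u × S u) × (Node Γ v × S v)

delete : Graph → ℕ → Graph
delete Γ x = induced Γ (λ m → m ≢ x)

II-t II-b : ℕ → ℕ
II-t k = 2 ^ k ∸ 2 ^ (k ∸ 2) ∸ 2
II-b k = 2 ^ (k ∸ 1) ∸ 1

B₂ : ℕ → Graph
B₂ k = induced (G k) (λ m → m ≡ 0 ⊎ ((II-b k ≤ m) × (m ≤ II-t k)))

ψ : ℕ → ℕ → ℕ
ψ k zero    = zero
ψ k (suc m) = suc m + 2 ^ (k ∸ 1)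

record IsColorIso (f : ℕ → ℕ) (Γ Δ : Graph) : Set where
  field
    maps-nodes : ∀ m → Node Γ m → Node Δ (f m)
    injective  : ∀ m n → Node Γ m → Node Γ n → f m ≡ f n → m ≡ n
    surjective : ∀ n → Node Δ n → ∃ λ m → Node Γ m × f m ≡ n
    edges      : ∀ c u v → Node Γ u → Node Γ v → (Edge Γ c u v ⇔ Edge Δ c (f u) (f v))

-- Write K = 2^(k-1). Apart from 0, the nodes of G_k without its top node form the interval
-- [K-1, 2K-2], which is exactly the range of sources of blue (and targets of red) edges, and
-- those of B₂ of G_(k+1) form [2K-1, 3K-2]; ψ translates one onto the other by K, so it is a
-- bijection that commutes with successor, and blue edges correspond.  For red edges the point
-- is P₁(v + K) = ψ(P₁ v).  If v = K + r with r < K - 1, then r has a zero bit below position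
-- k-1, so adding a multiple of K changes neither the trailing ones of v nor the low bits they
-- clear, and P₁(v + K) = P₁ v + K.  The remaining node v = K - 1 = 1…1₂ and v + K = 2K - 1
-- both consist of ones only, and both sides vanish.

module Submission where

open import Defs
open import Data.Nat
open import Data.Nat.Properties
open import Data.Nat.DivMod
open import Data.Nat.Divisibility using (_∣_; divides; divides-refl; ∣-trans; m∣m*n)
open import Data.Nat.Solver using (module +-*-Solver)
open import Data.Product using (_×_; _,_; ∃; proj₂)
open import Data.Sum using (_⊎_; inj₁; inj₂)
open import Function.Base using (_∘_)
open import Function.Bundles using (_⇔_; mk⇔; Equivalence)
open import Relation.Binary.PropositionalEquality
open import Relation.Nullary using (yes; no; contradiction)

open +-*-Solver
open Equivalence using (to; from)

%2≡0⊎%2≡1 : ∀ m → m % 2 ≡ 0 ⊎ m % 2 ≡ 1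
%2≡0⊎%2≡1 m with m % 2 | m%n<n m 2
... | 0           | _               = inj₁ refl
... | 1           | _               = inj₂ refl
... | suc (suc _) | s≤s (s≤s ())

[m+n*2]/2≡m/2+n : ∀ m n → (m + n * 2) / 2 ≡ m / 2 + n
[m+n*2]/2≡m/2+n m n = trans (+-distrib-/-∣ʳ m (divides-refl n)) (cong (m / 2 +_) (m*n/n≡m n 2))

odd⇒suc[m/2]<n : ∀ {m n} → m % 2 ≡ 1 → suc m < 2 * n → suc (m / 2) < n
odd⇒suc[m/2]<n {m} {n} odd m<2n = *-cancelˡ-< 2 (suc (m / 2)) n (begin-strict
  2 * suc (m / 2)      ≡⟨ solve 1 (λ h → con 2 :* (con 1 :+ h) := con 2 :+ h :* con 2) refl (m / 2) ⟩
  2 + m / 2 * 2        ≡⟨ cong (1 +_) (sym m≡1+[m/2]*2) ⟩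
  suc m                <⟨ m<2n ⟩
  2 * n                ∎)
  where
  open ≤-Reasoning
  m≡1+[m/2]*2 : m ≡ 1 + m / 2 * 2
  m≡1+[m/2]*2 = trans (m≡m%n+[m/n]*n m 2) (cong (_+ m / 2 * 2) odd)

n<2^n : ∀ n → n < 2 ^ n
n<2^n zero    = z<s
n<2^n (suc n) = begin-strict
  suc n                ≤⟨ n<2^n n ⟩
  2 ^ n                <⟨ m<m+n (2 ^ n) (+-monoˡ-≤ 0 (m^n>0 2 n)) ⟩
  2 ^ n + (2 ^ n + 0)  ∎
  where open ≤-Reasoning

^-monoʳ-∣ : ∀ m {i j} → i ≤ j → m ^ i ∣ m ^ j
^-monoʳ-∣ m {i} {j} i≤j = divides (m ^ (j ∸ i)) (begin
  m ^ j                  ≡⟨ cong (m ^_) (sym (m+[n∸m]≡n i≤j)) ⟩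
  m ^ (i + (j ∸ i))      ≡⟨ ^-distribˡ-+-* m i (j ∸ i) ⟩
  m ^ i * m ^ (j ∸ i)    ≡⟨ *-comm (m ^ i) _ ⟩
  m ^ (j ∸ i) * m ^ i    ∎)
  where open ≡-Reasoning

1<2^j : ∀ j → 0 < j → 1 < 2 ^ j
1<2^j j = ^-monoʳ-< 2 (s≤s (s≤s z≤n))

2^[1+j]≡2^j+2^j : ∀ j → 2 ^ suc j ≡ 2 ^ j + 2 ^ j
2^[1+j]≡2^j+2^j j = cong (2 ^ j +_) (+-identityʳ (2 ^ j))

2^[2+j]∸2^j≡2^[1+j]+2^j : ∀ j → 2 ^ (2 + j) ∸ 2 ^ j ≡ 2 ^ suc j + 2 ^ j
2^[2+j]∸2^j≡2^[1+j]+2^j j = trans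
  (cong (_∸ 2 ^ j) (solve 1 (λ K → let L = K :+ (K :+ con 0) in L :+ (L :+ con 0) := L :+ K :+ K) refl (2 ^ j)))
  (m+n∸n≡m (2 ^ suc j + 2 ^ j) (2 ^ j))

[n∸1]+n≡2*n∸1 : ∀ n → 1 ≤ n → n ∸ 1 + n ≡ 2 * n ∸ 1
[n∸1]+n≡2*n∸1 (suc p) _ = cong (p +_) (sym (+-identityʳ (suc p)))

2^[1+j]+2^j≤2^[2+j] : ∀ j → 2 ^ suc j + 2 ^ j ≤ 2 ^ (2 + j)
2^[1+j]+2^j≤2^[2+j] j = +-monoʳ-≤ (2 ^ suc j) (≤-trans (m≤m+n (2 ^ j) _) (m≤m+n (2 ^ suc j) 0))

2*n∸1≡1+[n∸1]*2 : ∀ n → 1 ≤ n → 2 * n ∸ 1 ≡ 1 + (n ∸ 1) * 2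
2*n∸1≡1+[n∸1]*2 (suc p) _ = solve 1 (λ p → p :+ (con 1 :+ p :+ con 0) := con 1 :+ p :* con 2) refl p

m+n*[1+o]∸1≡m+n*o+[n∸1] : ∀ m n o → 1 ≤ n → m + n * suc o ∸ 1 ≡ m + n * o + (n ∸ 1)
m+n*[1+o]∸1≡m+n*o+[n∸1] m (suc p) o _ =
  trans (cong (_∸ 1) (+-suc m (o + p * suc o)))
        (solve 3 (λ m p o → m :+ (o :+ p :* (con 1 :+ o)) := m :+ (con 1 :+ p) :* o :+ p) refl m p o)

≤∸2⇔<∸1 : ∀ {c n} → 2 ≤ c → n ≤ c ∸ 2 ⇔ n < c ∸ 1
≤∸2⇔<∸1 (s≤s (s≤s _)) = mk⇔ s≤s s≤s⁻¹

trailingOnesF-even : ∀ f m → m % 2 ≡ 0 → trailingOnesF (suc f) m ≡ 0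
trailingOnesF-even f m even rewrite even = refl

trailingOnesF-odd : ∀ f m → m % 2 ≡ 1 → trailingOnesF (suc f) m ≡ suc (trailingOnesF f (m / 2))
trailingOnesF-odd f m odd rewrite odd = refl

trailingOnesF-≤ : ∀ f m → trailingOnesF f m ≤ f
trailingOnesF-≤ zero    m = z≤n
trailingOnesF-≤ (suc f) m with %2≡0⊎%2≡1 m
... | inj₁ even = subst (_≤ suc f) (sym (trailingOnesF-even f m even)) z≤n
... | inj₂ odd  = subst (_≤ suc f) (sym (trailingOnesF-odd f m odd)) (s≤s (trailingOnesF-≤ f (m / 2)))

trailingOnesF-+-multiple : ∀ j f g c m → j ≤ f → j ≤ g → suc m < 2 ^ j →
                           trailingOnesF f (m + 2 ^ j * c) ≡ trailingOnesF g m
trailingOnesF-+-multiple zero f g c m _ _ (s≤s ())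
trailingOnesF-+-multiple (suc j) (suc f) (suc g) c m (s≤s j≤f) (s≤s j≤g) m<2^[1+j] =
  byParity (%2≡0⊎%2≡1 m)
  where
  X = m + 2 ^ suc j * c
  X≡m+[2^j*c]*2 : X ≡ m + 2 ^ j * c * 2
  X≡m+[2^j*c]*2 = cong (m +_) (solve 2 (λ p c → (con 2 :* p) :* c := p :* c :* con 2) refl (2 ^ j) c)
  X%2≡m%2 : X % 2 ≡ m % 2
  X%2≡m%2 = trans (cong (_% 2) X≡m+[2^j*c]*2) ([m+kn]%n≡m%n m (2 ^ j * c) 2)
  X/2≡m/2+2^j*c : X / 2 ≡ m / 2 + 2 ^ j * c
  X/2≡m/2+2^j*c = trans (cong (_/ 2) X≡m+[2^j*c]*2) ([m+n*2]/2≡m/2+n m (2 ^ j * c))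
  byParity : m % 2 ≡ 0 ⊎ m % 2 ≡ 1 → trailingOnesF (suc f) X ≡ trailingOnesF (suc g) m
  byParity (inj₁ even) =
    trans (trailingOnesF-even f X (trans X%2≡m%2 even)) (sym (trailingOnesF-even g m even))
  byParity (inj₂ odd) = begin
    trailingOnesF (suc f) X                      ≡⟨ trailingOnesF-odd f X (trans X%2≡m%2 odd) ⟩
    suc (trailingOnesF f (X / 2))                ≡⟨ cong (suc ∘ trailingOnesF f) X/2≡m/2+2^j*c ⟩
    suc (trailingOnesF f (m / 2 + 2 ^ j * c))    ≡⟨ cong suc (trailingOnesF-+-multiple j f g c (m / 2) j≤f j≤g
                                                                (odd⇒suc[m/2]<n odd m<2^[1+j])) ⟩
    suc (trailingOnesF g (m / 2))                ≡⟨ sym (trailingOnesF-odd g m odd) ⟩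
    trailingOnesF (suc g) m                      ∎
    where open ≡-Reasoning

trailingOnesF-2^j∸1 : ∀ j f → j ≤ f → trailingOnesF f (2 ^ j ∸ 1) ≡ j
trailingOnesF-2^j∸1 zero    zero    _         = refl
trailingOnesF-2^j∸1 zero    (suc f) _         = refl
trailingOnesF-2^j∸1 (suc j) (suc f) (s≤s j≤f) = begin
  trailingOnesF (suc f) (2 ^ suc j ∸ 1)   ≡⟨ cong (trailingOnesF (suc f)) X≡1+p*2 ⟩
  trailingOnesF (suc f) (1 + p * 2)       ≡⟨ trailingOnesF-odd f (1 + p * 2) ([m+kn]%n≡m%n 1 p 2) ⟩
  suc (trailingOnesF f ((1 + p * 2) / 2)) ≡⟨ cong (suc ∘ trailingOnesF f) ([m+n*2]/2≡m/2+n 1 p) ⟩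
  suc (trailingOnesF f p)                 ≡⟨ cong suc (trailingOnesF-2^j∸1 j f j≤f) ⟩
  suc j                                   ∎
  where
  open ≡-Reasoning
  p = 2 ^ j ∸ 1
  X≡1+p*2 = 2*n∸1≡1+[n∸1]*2 (2 ^ j) (m^n>0 2 j)

-- The paper's q; P₁ m unfolds to clearLowBits (trailingOnes m) m ∸ 1.
clearLowBits : ℕ → ℕ → ℕ
clearLowBits z m = 2 ^ z * (m / 2 ^ z)
  where instance _ = >-nonZero (m^n>0 2 z)

clearLowBits-+-multiple : ∀ {z j} r c → z ≤ j → clearLowBits z (r + 2 ^ j * c) ≡ clearLowBits z r + 2 ^ j * c
clearLowBits-+-multiple {z} {j} r c z≤j = begin
  2 ^ z * ((r + d) / 2 ^ z)                  ≡⟨ cong (2 ^ z *_) (+-distrib-/-∣ʳ r 2^z∣d) ⟩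
  2 ^ z * (r / 2 ^ z + d / 2 ^ z)            ≡⟨ *-distribˡ-+ (2 ^ z) (r / 2 ^ z) (d / 2 ^ z) ⟩
  2 ^ z * (r / 2 ^ z) + 2 ^ z * (d / 2 ^ z)  ≡⟨ cong (clearLowBits z r +_) (m*[n/m]≡n 2^z∣d) ⟩
  clearLowBits z r + d                       ∎
  where
  open ≡-Reasoning
  instance _ = >-nonZero (m^n>0 2 z)
  d = 2 ^ j * c
  2^z∣d : 2 ^ z ∣ d
  2^z∣d = ∣-trans (^-monoʳ-∣ 2 z≤j) (m∣m*n c)

P₁-2^j∸1 : ∀ j → P₁ (2 ^ j ∸ 1) ≡ 0
P₁-2^j∸1 j = begin
  clearLowBits (trailingOnes m) m ∸ 1  ≡⟨ cong (λ z → clearLowBits z m ∸ 1) (trailingOnesF-2^j∸1 j m j≤m) ⟩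
  2 ^ j * (m / 2 ^ j) ∸ 1              ≡⟨ cong (λ q → 2 ^ j * q ∸ 1) (m<n⇒m/n≡0 m<2^j) ⟩
  2 ^ j * 0 ∸ 1                        ≡⟨ cong (_∸ 1) (*-zeroʳ (2 ^ j)) ⟩
  0                                    ∎
  where
  open ≡-Reasoning
  instance _ = >-nonZero (m^n>0 2 j)
  m = 2 ^ j ∸ 1
  j≤m : j ≤ m
  j≤m = <⇒≤pred (n<2^n j)
  m<2^j : m < 2 ^ j
  m<2^j = ∸-monoʳ-< z<s (m^n>0 2 j)

P₁-+-2^j*suc : ∀ j r c → suc r < 2 ^ j →
               P₁ (r + 2 ^ j * suc c) ≡ clearLowBits (trailingOnesF j r) r + 2 ^ j * c + (2 ^ j ∸ 1)
P₁-+-2^j*suc j r c r<2^j = begin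
  clearLowBits (trailingOnes X) X ∸ 1  ≡⟨ cong (λ z → clearLowBits z X ∸ 1)
                                            (trailingOnesF-+-multiple j X j (suc c) r j≤X ≤-refl r<2^j) ⟩
  clearLowBits z X ∸ 1                 ≡⟨ cong (_∸ 1) (clearLowBits-+-multiple r (suc c) (trailingOnesF-≤ j r)) ⟩
  clearLowBits z r + 2 ^ j * suc c ∸ 1 ≡⟨ m+n*[1+o]∸1≡m+n*o+[n∸1] (clearLowBits z r) (2 ^ j) c (m^n>0 2 j) ⟩
  clearLowBits z r + 2 ^ j * c + (2 ^ j ∸ 1) ∎
  where
  open ≡-Reasoning
  X = r + 2 ^ j * suc c
  z = trailingOnesF j r
  j≤X : j ≤ X
  j≤X = ≤-trans (<⇒≤ (n<2^n j)) (≤-trans (m≤m*n (2 ^ j) (suc c)) (m≤n+m _ r))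

-- The edge conditions of G k restrict the source of a blue edge, and the target of a red
-- edge, to InBand (2 ^ (k ∸ 1)) (2 ^ k).
InBand : ℕ → ℕ → ℕ → Set
InBand a b m = a ∸ 1 ≤ m × m < b ∸ 1

ZeroOrInBand : ℕ → ℕ → ℕ → Set
ZeroOrInBand a b m = m ≡ 0 ⊎ InBand a b m

∸1≤⇔≤suc : ∀ {a m} → a ∸ 1 ≤ m ⇔ a ≤ suc m
∸1≤⇔≤suc {zero}  = mk⇔ (λ _ → z≤n) (λ _ → z≤n)
∸1≤⇔≤suc {suc a} = mk⇔ s≤s s≤s⁻¹

<∸1⇔suc< : ∀ {b m} → m < b ∸ 1 ⇔ suc m < b
<∸1⇔suc< {zero}  = mk⇔ (λ ()) (λ ())
<∸1⇔suc< {suc b} = mk⇔ s≤s s≤s⁻¹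

InBand-+ʳ : ∀ a b {m} c → InBand a b m ⇔ InBand (a + c) (b + c) (m + c)
InBand-+ʳ a b {m} c = mk⇔ shift unshift
  where
  shift : InBand a b m → InBand (a + c) (b + c) (m + c)
  shift (lo , hi) = from (∸1≤⇔≤suc {a + c}) (+-monoˡ-≤ c (to (∸1≤⇔≤suc {a}) lo)) ,
                    from (<∸1⇔suc< {b + c}) (+-monoˡ-< c (to (<∸1⇔suc< {b}) hi))
  unshift : InBand (a + c) (b + c) (m + c) → InBand a b m
  unshift (lo , hi) = from (∸1≤⇔≤suc {a}) (+-cancelʳ-≤ c a (suc m) (to (∸1≤⇔≤suc {a + c}) lo)) ,
                      from (<∸1⇔suc< {b}) (+-cancelʳ-< c (suc m) b (to (<∸1⇔suc< {b + c}) hi))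

InBand-+ʳ-split : ∀ a b {n} c → 1 ≤ a → InBand (a + c) (b + c) n → ∃ λ m → InBand a b m × m + c ≡ n
InBand-+ʳ-split a b {n} c 1≤a band@(lo , _) =
  n ∸ c , from (InBand-+ʳ a b c) (subst (InBand (a + c) (b + c)) (sym n∸c+c≡n) band) , n∸c+c≡n
  where
  c≤n : c ≤ n
  c≤n = s≤s⁻¹ (≤-trans (+-monoˡ-≤ c 1≤a) (to (∸1≤⇔≤suc {a + c}) lo))
  n∸c+c≡n : n ∸ c + c ≡ n
  n∸c+c≡n = m∸n+n≡m c≤n

InBand-weakenʳ : ∀ {a} b {b′ m} → b ≤ b′ → InBand a b m → InBand a b′ m
InBand-weakenʳ b b≤b′ (lo , hi) = lo , <-≤-trans hi (∸-monoˡ-≤ {b} 1 b≤b′)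

InBand⇒≢0 : ∀ {a} b {m} → 2 ≤ a → InBand a b m → m ≢ 0
InBand⇒≢0 _ {zero}  (s≤s (s≤s _)) (() , _)
InBand⇒≢0 _ {suc _} _             _        ()

ψ-≢0 : ∀ k {m} → m ≢ 0 → ψ k m ≡ m + 2 ^ (k ∸ 1)
ψ-≢0 k {zero}  m≢0 = contradiction refl m≢0
ψ-≢0 k {suc m} _   = refl

ψ-suc : ∀ k {m} → m ≢ 0 → ψ k (suc m) ≡ suc (ψ k m)
ψ-suc k {zero}  m≢0 = contradiction refl m≢0
ψ-suc k {suc m} _   = refl

ψ-injective : ∀ k {m n} → ψ k m ≡ ψ k n → m ≡ n
ψ-injective k {zero}  {zero}  _ = refl
ψ-injective k {suc m} {suc n} e = +-cancelʳ-≡ (2 ^ (k ∸ 1)) (suc m) (suc n) e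

ψ-cong⇔ : ∀ k {m n} → m ≡ n ⇔ ψ k m ≡ ψ k n
ψ-cong⇔ k = mk⇔ (cong (ψ k)) (ψ-injective k)

P₁-+2^j : ∀ j → 0 < j → ∀ {v} → InBand (2 ^ j) (2 ^ suc j) v → P₁ (v + 2 ^ j) ≡ ψ (suc j) (P₁ v)
P₁-+2^j j 0<j {v} band@(lo , _) with 2 ^ j ≤? v
... | no v≱K = begin
  P₁ (v + K)              ≡⟨ cong (λ x → P₁ (x + K)) v≡K∸1 ⟩
  P₁ (K ∸ 1 + K)          ≡⟨ cong P₁ ([n∸1]+n≡2*n∸1 K (m^n>0 2 j)) ⟩
  P₁ (2 ^ suc j ∸ 1)      ≡⟨ P₁-2^j∸1 (suc j) ⟩
  ψ (suc j) 0             ≡⟨ cong (ψ (suc j)) (sym (P₁-2^j∸1 j)) ⟩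
  ψ (suc j) (P₁ (K ∸ 1))  ≡⟨ cong (ψ (suc j) ∘ P₁) (sym v≡K∸1) ⟩
  ψ (suc j) (P₁ v)        ∎
  where
  open ≡-Reasoning
  K = 2 ^ j
  v≡K∸1 : v ≡ K ∸ 1
  v≡K∸1 = ≤-antisym (<⇒≤pred (≰⇒> v≱K)) lo
... | yes K≤v = begin
  P₁ (v + K)                 ≡⟨ cong P₁ v+K≡r+K*2 ⟩
  P₁ (r + K * 2)             ≡⟨ P₁-+-2^j*suc j r 1 suc[r]<K ⟩
  b + K * 1 + (K ∸ 1)        ≡⟨ solve 3 (λ b K p → b :+ K :* con 1 :+ p := b :+ K :* con 0 :+ p :+ K) refl b K (K ∸ 1) ⟩
  b + K * 0 + (K ∸ 1) + K    ≡⟨ cong (_+ K) (sym P₁v≡b+K*0+[K∸1]) ⟩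
  P₁ v + K                   ≡⟨ sym (ψ-≢0 (suc j) P₁v≢0) ⟩
  ψ (suc j) (P₁ v)           ∎
  where
  open ≡-Reasoning
  K = 2 ^ j
  r = v ∸ K
  b = clearLowBits (trailingOnesF j r) r
  r+K≡v : r + K ≡ v
  r+K≡v = m∸n+n≡m K≤v
  suc[r]<K : suc r < K
  suc[r]<K = to (<∸1⇔suc< {K}) (proj₂ (from (InBand-+ʳ 0 K K)
    (subst₂ (InBand K) (2^[1+j]≡2^j+2^j j) (sym r+K≡v) band)))
  v+K≡r+K*2 : v + K ≡ r + K * 2
  v+K≡r+K*2 = trans (cong (_+ K) (sym r+K≡v)) (solve 2 (λ r K → r :+ K :+ K := r :+ K :* con 2) refl r K)
  P₁v≡b+K*0+[K∸1] : P₁ v ≡ b + K * 0 + (K ∸ 1)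
  P₁v≡b+K*0+[K∸1] = trans (cong P₁ (trans (sym r+K≡v) (cong (r +_) (sym (*-identityʳ K)))))
                          (P₁-+-2^j*suc j r 0 suc[r]<K)
  P₁v≢0 : P₁ v ≢ 0
  P₁v≢0 = subst (_≢ 0) (sym P₁v≡b+K*0+[K∸1])
                (m<n⇒n≢0 (<-≤-trans (m<n⇒0<n∸m (1<2^j j 0<j)) (m≤n+m (K ∸ 1) _)))

×-⇔ᵈ : ∀ {a b c d} {A : Set a} {B : Set b} {C : Set c} {D : Set d} →
       A ⇔ B → (A → C ⇔ D) → (A × C) ⇔ (B × D)
×-⇔ᵈ A⇔B C⇔D = mk⇔ (λ (x , z) → to A⇔B x , to (C⇔D x) z)
                   (λ (y , w) → let x = from A⇔B y in x , from (C⇔D x) w)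

delete-top-node⇔ : ∀ j {m} → Node (delete (G (suc j)) (2 ^ suc j ∸ 1)) m ⇔ ZeroOrInBand (2 ^ j) (2 ^ suc j) m
delete-top-node⇔ j = mk⇔ restrict extend
  where
  restrict : ∀ {m} → Node (delete (G (suc j)) (2 ^ suc j ∸ 1)) m → ZeroOrInBand (2 ^ j) (2 ^ suc j) m
  restrict (inj₁ m≡0 , _)            = inj₁ m≡0
  restrict (inj₂ (lo , hi) , m≢top) = inj₂ (lo , ≤∧≢⇒< hi m≢top)
  extend : ∀ {m} → ZeroOrInBand (2 ^ j) (2 ^ suc j) m → Node (delete (G (suc j)) (2 ^ suc j ∸ 1)) m
  extend (inj₁ refl)       = inj₁ refl , <⇒≢ (m<n⇒0<n∸m (1<2^j (suc j) z<s))
  extend (inj₂ (lo , hi)) = inj₂ (lo , <⇒≤ hi) , <⇒≢ hi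

B₂-node⇔ : ∀ j {n} → Node (B₂ (2 + j)) n ⇔ ZeroOrInBand (2 ^ suc j) (2 ^ suc j + 2 ^ j) n
B₂-node⇔ j = mk⇔ restrict extend
  where
  2≤3K : 2 ≤ 2 ^ suc j + 2 ^ j
  2≤3K = ≤-trans (1<2^j (suc j) z<s) (m≤m+n (2 ^ suc j) (2 ^ j))
  top≡ : ∀ n → n ≤ II-t (2 + j) ⇔ n ≤ 2 ^ suc j + 2 ^ j ∸ 2
  top≡ n = mk⇔ (subst (λ t → n ≤ t ∸ 2) (2^[2+j]∸2^j≡2^[1+j]+2^j j))
               (subst (λ t → n ≤ t ∸ 2) (sym (2^[2+j]∸2^j≡2^[1+j]+2^j j)))
  restrict : ∀ {n} → Node (B₂ (2 + j)) n → ZeroOrInBand (2 ^ suc j) (2 ^ suc j + 2 ^ j) n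
  restrict (_ , inj₁ n≡0)            = inj₁ n≡0
  restrict {n} (_ , inj₂ (lo , hi)) = inj₂ (lo , to (≤∸2⇔<∸1 2≤3K) (to (top≡ n) hi))
  extend : ∀ {n} → ZeroOrInBand (2 ^ suc j) (2 ^ suc j + 2 ^ j) n → Node (B₂ (2 + j)) n
  extend (inj₁ refl)           = inj₁ refl , inj₁ refl
  extend {n} (inj₂ (lo , hi)) =
    inj₂ (lo , ≤-trans (<⇒≤ hi) (∸-monoˡ-≤ 1 (2^[1+j]+2^j≤2^[2+j] j))) ,
    inj₂ (lo , from (top≡ n) (from (≤∸2⇔<∸1 2≤3K) hi))

ψ-InBand : ∀ j {m} → m ≢ 0 → InBand (2 ^ j) (2 ^ suc j) m → InBand (2 ^ suc j) (2 ^ suc j + 2 ^ j) (ψ (suc j) m)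
ψ-InBand j {m} m≢0 band =
  subst₂ (λ a n → InBand a (2 ^ suc j + 2 ^ j) n) (sym (2^[1+j]≡2^j+2^j j)) (sym (ψ-≢0 (suc j) m≢0))
         (to (InBand-+ʳ (2 ^ j) (2 ^ suc j) (2 ^ j)) band)

ψ-maps : ∀ j {m} → ZeroOrInBand (2 ^ j) (2 ^ suc j) m →
         ZeroOrInBand (2 ^ suc j) (2 ^ suc j + 2 ^ j) (ψ (suc j) m)
ψ-maps j {zero}  _           = inj₁ refl
ψ-maps j {suc m} (inj₂ band) = inj₂ (ψ-InBand j (λ ()) band)

ψ-onto : ∀ j → 0 < j → ∀ {n} → ZeroOrInBand (2 ^ suc j) (2 ^ suc j + 2 ^ j) n →
         ∃ λ m → ZeroOrInBand (2 ^ j) (2 ^ suc j) m × ψ (suc j) m ≡ n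
ψ-onto j 0<j (inj₁ refl) = 0 , inj₁ refl , refl
ψ-onto j 0<j {n} (inj₂ band)
  with InBand-+ʳ-split (2 ^ j) (2 ^ suc j) (2 ^ j) (m^n>0 2 j)
         (subst (λ a → InBand a (2 ^ suc j + 2 ^ j) n) (2^[1+j]≡2^j+2^j j) band)
... | m , m∈ , m+K≡n = m , inj₂ m∈ , trans (ψ-≢0 (suc j) (InBand⇒≢0 (2 ^ suc j) (1<2^j j 0<j) m∈)) m+K≡n

band-ψ⇔ : ∀ j → 0 < j → ∀ {m} → ZeroOrInBand (2 ^ j) (2 ^ suc j) m →
          InBand (2 ^ j) (2 ^ suc j) m ⇔ InBand (2 ^ suc j) (2 ^ (2 + j)) (ψ (suc j) m)
band-ψ⇔ j 0<j {m} m∈ = mk⇔ forth (back m∈)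
  where
  forth : InBand (2 ^ j) (2 ^ suc j) m → InBand (2 ^ suc j) (2 ^ (2 + j)) (ψ (suc j) m)
  forth band = InBand-weakenʳ {2 ^ suc j} (2 ^ suc j + 2 ^ j) (2^[1+j]+2^j≤2^[2+j] j)
                 (ψ-InBand j (InBand⇒≢0 (2 ^ suc j) (1<2^j j 0<j) band) band)
  back : ZeroOrInBand (2 ^ j) (2 ^ suc j) m →
         InBand (2 ^ suc j) (2 ^ (2 + j)) (ψ (suc j) m) → InBand (2 ^ j) (2 ^ suc j) m
  back (inj₁ refl) band = contradiction refl (InBand⇒≢0 (2 ^ (2 + j)) (1<2^j (suc j) z<s) band)
  back (inj₂ band) _    = band

G-edge⇔ : ∀ j → 0 < j → ∀ c {u v} → ZeroOrInBand (2 ^ j) (2 ^ suc j) u → ZeroOrInBand (2 ^ j) (2 ^ suc j) v →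
          Edge (G (suc j)) c u v ⇔ Edge (G (2 + j)) c (ψ (suc j) u) (ψ (suc j) v)
G-edge⇔ j 0<j blue {u} {v} u∈ _ = ×-⇔ᵈ (band-ψ⇔ j 0<j u∈) λ band →
  subst (λ w → v ≡ suc u ⇔ ψ (suc j) v ≡ w)
        (ψ-suc (suc j) (InBand⇒≢0 (2 ^ suc j) (1<2^j j 0<j) band)) (ψ-cong⇔ (suc j))
G-edge⇔ j 0<j red {u} {v} _ v∈ = ×-⇔ᵈ (band-ψ⇔ j 0<j v∈) λ band →
  subst (λ w → u ≡ P₁ v ⇔ ψ (suc j) u ≡ w)
        (trans (sym (P₁-+2^j j 0<j band)) (cong P₁ (sym (ψ-≢0 (suc j) (InBand⇒≢0 (2 ^ suc j) (1<2^j j 0<j) band)))))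
        (ψ-cong⇔ (suc j))

mainTheorem7 : (k : ℕ) → 2 ≤ k → IsColorIso (ψ k) (delete (G k) (2 ^ k ∸ 1)) (B₂ (suc k))
mainTheorem7 (suc j) (s≤s 0<j) = record
  { maps-nodes = maps
  ; injective  = λ _ _ _ _ → ψ-injective (suc j)
  ; surjective = λ n n∈ → let (m , m∈ , ψm≡n) = ψ-onto j 0<j (to (B₂-node⇔ j) n∈)
                          in m , from (delete-top-node⇔ j) m∈ , ψm≡n
  ; edges      = λ c u v u∈ v∈ →
      let ψ-edge = G-edge⇔ j 0<j c (to (delete-top-node⇔ j) u∈) (to (delete-top-node⇔ j) v∈)
      in mk⇔ (λ (e , _ , _) → to ψ-edge e , maps u u∈ , maps v v∈)
             (λ (e , _ , _) → from ψ-edge e , u∈ , v∈)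
  }
  where
  maps : ∀ m → Node (delete (G (suc j)) (2 ^ suc j ∸ 1)) m → Node (B₂ (2 + j)) (ψ (suc j) m)
  maps _ m∈ = from (B₂-node⇔ j) (ψ-maps j (to (delete-top-node⇔ j) m∈))
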